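{- Let $G$ be a connected graph and let $X\subseteq V(G)$ be a twin cover of $G$. Then \[ \chi(G)=\min_{\varphi\text{ proper coloring of } G[X]}\ \max_{S\subseteq X}\bigl(|\varphi(S)|+m(S)\bigr). \]
   Context: All graphs are finite, simple and undirected; $\chi(G)$ is the chromatic number. Vertices $u\neq v$ are true twins if $N_G[u]=N_G[v]$; a twin edge is an edge whose endpoints are true twins; $X\subseteq V(G)$ is a twin cover of $G$ if every edge of $G-X$ is a twin edge. A twin-clique is a connected component of $G-X$; each twin-clique $C$ is a clique whose vertices all have the same neighborhood in $X$, denoted $N_X(C)$. For $S\subseteq X$, $m(S)$ is the maximum size of a twin-clique $C$ with $N_X(C)=S$, and $m(S)=0$ if there is none. $\varphi(S):=\{\varphi(x):x\in S\}$. -}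

module Defs where

open import Data.Nat using (ℕ; zero; suc; _+_; _≤_)
import Data.Nat.Properties as ℕP
open import Data.Bool using (Bool; true; false; _∧_)
open import Data.Fin using (Fin)
open import Data.Fin.Subset using (Subset; _∈_; _∉_; _⊆_; ∣_∣; Nonempty)
open import Data.Vec using (lookup; tabulate)
open import Data.List using (List; map; filter; length; deduplicate)
open import Data.Bool.ListAction using (any)
open import Data.List.Base using (allFin)
open import Data.Product using (Σ; ∃; ∃-syntax; _×_; _,_)
open import Data.Sum using (_⊎_)
open import Relation.Binary.PropositionalEquality using (_≡_; _≢_)
open import Function.Bundles using (_⇔_)
open import Data.Fin.Subset.Properties using (_∈?_)

record Graph (n : ℕ) : Set where
  field
    adj    : Fin n → Fin n → Bool
    sym    : ∀ u v → adj u v ≡ adj v u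
    irrefl : ∀ v → adj v v ≡ false

open Graph public

module _ {n : ℕ} (G : Graph n) where

  Edge : Fin n → Fin n → Set
  Edge u v = adj G u v ≡ true

  data WalkIn (P : Fin n → Set) : Fin n → Fin n → Set where
    here : ∀ {u} → P u → WalkIn P u u
    step : ∀ {u v w} → P u → Edge u v → WalkIn P v w → WalkIn P u w

  Connected : Set
  Connected = ∀ u v → WalkIn (λ _ → Fin n) u v

  InClosedNbhd : Fin n → Fin n → Set
  InClosedNbhd u w = w ≡ u ⊎ Edge u w

  TrueTwins : Fin n → Fin n → Set
  TrueTwins u v = u ≢ v × (∀ w → InClosedNbhd u w ⇔ InClosedNbhd v w)

  TwinEdge : Fin n → Fin n → Set
  TwinEdge u v = Edge u v × TrueTwins u v

  TwinCover : Subset n → Set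
  TwinCover X = ∀ u v → u ∉ X → v ∉ X → Edge u v → TwinEdge u v

  -- C is (the vertex set of) a connected component of G - X
  TwinClique : Subset n → Subset n → Set
  TwinClique X C =
    Nonempty C
    × (∀ v → v ∈ C → v ∉ X)
    × (∀ u v → u ∈ C → v ∈ C → WalkIn (λ w → w ∉ X) u v)
    × (∀ u w → u ∈ C → w ∉ X → Edge u w → w ∈ C)

  NX : Subset n → Subset n → Subset n
  NX X C = tabulate λ x →
    lookup X x ∧ any (λ c → lookup C c ∧ adj G x c) (allFin n)

  -- IsM X S k : k = m(S), the maximum size of a twin-clique C with
  -- N_X(C) = S, or 0 if there is none.
  IsM : Subset n → Subset n → ℕ → Set
  IsM X S k =
    (∀ C → TwinClique X C → NX X C ≡ S → ∣ C ∣ ≤ k)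
    × (k ≡ 0 ⊎ ∃[ C ] (TwinClique X C × NX X C ≡ S × ∣ C ∣ ≡ k))

  ProperColouring : (k : ℕ) → (Fin n → Fin k) → Set
  ProperColouring k c = ∀ u v → Edge u v → c u ≢ c v

  Colourable : ℕ → Set
  Colourable k = Σ (Fin n → Fin k) (ProperColouring k)

  IsChromaticNumber : ℕ → Set
  IsChromaticNumber k = Colourable k × (∀ j → Colourable j → k ≤ j)

  ProperColouringOn : Subset n → (Fin n → ℕ) → Set
  ProperColouringOn X φ = ∀ x y → x ∈ X → y ∈ X → Edge x y → φ x ≢ φ y

elems : ∀ {n} → Subset n → List (Fin n)
elems {n} S = filter (_∈? S) (allFin n)

imageSize : ∀ {n} → (Fin n → ℕ) → Subset n → ℕ
imageSize φ S = length (deduplicate ℕP._≟_ (map φ (elems S)))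

module _ {n : ℕ} (G : Graph n) (X : Subset n) where

  IsMaxValue : (Fin n → ℕ) → ℕ → Set
  IsMaxValue φ v =
    (∀ S k → S ⊆ X → IsM G X S k → imageSize φ S + k ≤ v)
    × ∃[ S ] ∃[ k ] (S ⊆ X × IsM G X S k × imageSize φ S + k ≡ v)

  IsMinMaxValue : ℕ → Set
  IsMinMaxValue v =
    (∃[ φ ] (ProperColouringOn G X φ × IsMaxValue φ v))
    × (∀ φ w → ProperColouringOn G X φ → IsMaxValue φ w → v ≤ w)

-- Restricting a proper colouring c of G to X gives a proper colouring φ of G[X]. The edges of G - X
-- are twin edges, so the vertices of a twin-clique C (connected in G - X) are pairwise true twins: C is
-- a clique joined to every vertex of N_X(C). Hence c uses |φ(S)| + m(S) distinct colours on S and a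
-- largest twin-clique over S, i.e. max_S (|φ(S)| + m(S)) ≤ χ(G).
-- Conversely, let φ be a proper colouring of G[X] with |φ(S)| + m(S) ≤ w for all S ⊆ X. Rename the
-- colours of φ(X) to 0, …, |φ(X)| - 1 < w and give the vertices of each twin-clique C distinct colours
-- below w not used on N_X(C); there are at least w - |φ(N_X(C))| ≥ m(N_X(C)) ≥ |C| of them. Distinct
-- twin-cliques are non-adjacent, so this is a proper w-colouring of G.

module Submission where

open import Defs hiding (sym)
open import Data.Nat using (ℕ; zero; suc; _+_; _≤_; _<_; z≤n; s≤s; _<?_)
open import Data.Nat.Properties as ℕ
  using (≤-antisym; ≤-trans; <-≤-trans; ≮⇒≥; <⇒≱; 1+n≰n; n≤0⇒n≡0; m≤m+n; +-mono-≤; +-monoʳ-≤;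
         +-cancelˡ-≤; +-identityʳ; module ≤-Reasoning)
open import Data.Bool using (Bool; true; false; T; _∧_)
import Data.Bool.Properties as 𝔹
open import Data.Fin as Fin using (Fin; toℕ; fromℕ<; finToFun; funToFin)
open import Data.Fin.Properties using (any?; all?; toℕ<n; toℕ-injective; toℕ-fromℕ<; finToFun-funToFin)
open import Data.Fin.Subset using (Subset; _∈_; _∉_; _⊆_; ∣_∣)
open import Data.Fin.Subset.Properties using (_∈?_; _⊆?_; ⊆-refl; ⊆-antisym; ∣p∣≤n; anySubset?)
open import Data.Vec using (lookup; tabulate; []; _∷_)
import Data.List as List
open import Data.Vec.Properties using (lookup∘tabulate; lookup⇒[]=; []=⇒lookup; ≡-dec)
open import Data.List using (List; []; _∷_; length; map; filter; upTo; allFin; _++_; deduplicate)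
open import Data.List.Properties
  using (length-map; length-++; length-upTo; length-deduplicate; filter-notAll)
import Data.List.Relation.Unary.Any as Any
open import Data.List.Relation.Unary.Any using (here; there)
import Data.List.Relation.Unary.All as All
import Data.List.Relation.Unary.All.Properties as AllProperties
open import Data.List.Relation.Unary.AllPairs using ([]; _∷_)
open import Data.List.Relation.Unary.Any.Properties using (any⁺; any⁻)
open import Data.List.Relation.Unary.Unique.Propositional using (Unique)
open import Data.List.Relation.Unary.Unique.Propositional.Properties using (++⁺; filter⁺; allFin⁺; upTo⁺)
open import Data.List.Relation.Unary.Unique.DecPropositional.Properties ℕ._≟_ using (deduplicate-!)
open import Data.List.Membership.Propositional using (lose) renaming (_∈_ to _∈ˡ_; _∉_ to _∉ˡ_)
open import Data.List.Membership.Propositional.Properties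
  using (∈-map⁺; ∈-map⁻; ∈-filter⁺; ∈-filter⁻; ∈-allFin; ∈-upTo⁺; ∈-upTo⁻; ∈-++⁺ˡ; ∈-++⁺ʳ; ∈-++⁻;
         ∈-deduplicate⁺; ∈-deduplicate⁻)
open import Data.List.Membership.DecPropositional ℕ._≟_ using () renaming (_∈?_ to _∈ˡ?_)
open import Data.List.Relation.Binary.Subset.Propositional using () renaming (_⊆_ to _⊆ˡ_)
open import Data.Product as Product using (∃; ∃-syntax; _×_; _,_; proj₁; proj₂)
open import Data.Sum as Sum using (_⊎_; inj₁; inj₂)
open import Function using (id; _∘_; _⇔_; mk⇔; Equivalence)
import Function.Properties.Equivalence as ⇔
open import Relation.Nullary using (Dec; does; yes; no; ¬_; ¬?; contradiction)
open import Relation.Nullary.Decidable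
  using (isYes; map′; toWitness; fromWitness; _×-dec_; _⊎-dec_; _→-dec_)
open import Relation.Unary using (Decidable)
open import Relation.Binary using (DecidableEquality)
open import Relation.Binary.PropositionalEquality using (_≡_; _≢_; refl; sym; trans; cong; subst; _≗_;
  module ≡-Reasoning)

open Equivalence using (to; from)

least : {P : ℕ → Set} → Decidable P → ∀ {N} → P N → ∃[ k ] (P k × (∀ j → P j → k ≤ j))
least P? {zero} p0 = 0 , p0 , λ _ _ → z≤n
least P? {suc N} pN with P? 0
... | yes p0 = 0 , p0 , λ _ _ → z≤n
... | no ¬p0 with least (P? ∘ suc) {N} pN
...   | k , pk , k-least =
  suc k , pk , λ { zero p0 → contradiction p0 ¬p0 ; (suc j) pj → s≤s (k-least j pj) }

module _ {A : Set} (P : A → Set) (f : A → ℕ) where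

  IsMax₀ : ℕ → Set
  IsMax₀ k = (∀ a → P a → f a ≤ k) × (k ≡ 0 ⊎ ∃[ a ] (P a × f a ≡ k))

  Exceeded : ℕ → Set
  Exceeded t = ∃[ a ] (P a × t < f a)

  ∃-IsMax₀ : Decidable Exceeded → ∀ {B} → (∀ a → P a → f a ≤ B) → ∃ IsMax₀
  ∃-IsMax₀ exceeds? B-bound =
    let k , k-bound , k-least = least upperBound? B-bound in k , k-bound , attained k-bound k-least
    where
      UpperBound : ℕ → Set
      UpperBound t = ∀ a → P a → f a ≤ t

      notExceeded⇒upperBound : ∀ {t} → ¬ Exceeded t → UpperBound t
      notExceeded⇒upperBound ¬exceeded a pa = ≮⇒≥ (λ t<fa → ¬exceeded (a , pa , t<fa))

      upperBound? : Decidable UpperBound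
      upperBound? t = map′ notExceeded⇒upperBound (λ bound (a , pa , t<fa) → <⇒≱ t<fa (bound a pa))
                           (¬? (exceeds? t))

      attained : ∀ {k} → UpperBound k → (∀ j → UpperBound j → k ≤ j) → k ≡ 0 ⊎ ∃[ a ] (P a × f a ≡ k)
      attained {zero} _ _ = inj₁ refl
      attained {suc t} k-bound k-least with exceeds? t
      ... | yes (a , pa , t<fa) = inj₂ (a , pa , ≤-antisym (k-bound a pa) t<fa)
      ... | no ¬exceeded = contradiction (k-least t (notExceeded⇒upperBound ¬exceeded)) 1+n≰n

anyFunction? : ∀ {m k} {Q : (Fin m → Fin k) → Set} → (∀ {f g} → f ≗ g → Q f → Q g) →
               Decidable Q → Dec (∃ Q)
anyFunction? Q-resp Q? =
  map′ (λ (i , qi) → finToFun i , qi) (λ (f , qf) → funToFin f , Q-resp (sym ∘ finToFun-funToFin f) qf)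
       (any? (Q? ∘ finToFun))

module _ {A : Set} where

  Unique-map⁺ : ∀ {B : Set} {f : A → B} {xs} → (∀ {x y} → x ∈ˡ xs → y ∈ˡ xs → f x ≡ f y → x ≡ y) →
                Unique xs → Unique (map f xs)
  Unique-map⁺ {xs = []} _ [] = []
  Unique-map⁺ {xs = x ∷ xs} injective (x∉xs ∷ xs-unique) =
      AllProperties.map⁺ (All.tabulate λ y∈xs fx≡fy →
        All.lookup x∉xs y∈xs (injective (here refl) (there y∈xs) fx≡fy))
    ∷ Unique-map⁺ (λ x∈ y∈ → injective (there x∈) (there y∈)) xs-unique

  nth : A → List A → ℕ → A
  nth d [] _ = d
  nth d (x ∷ xs) zero = x
  nth d (x ∷ xs) (suc i) = nth d xs i

  nth-∈ : ∀ d {xs i} → i < length xs → nth d xs i ∈ˡ xs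
  nth-∈ d {x ∷ xs} {zero} _ = here refl
  nth-∈ d {x ∷ xs} {suc i} (s≤s i<) = there (nth-∈ d i<)

  nth-injective : ∀ d {xs i j} → Unique xs → i < length xs → j < length xs → nth d xs i ≡ nth d xs j → i ≡ j
  nth-injective d {x ∷ xs} {zero} {zero} _ _ _ _ = refl
  nth-injective d {x ∷ xs} {zero} {suc j} (x∉xs ∷ _) _ (s≤s j<) eq =
    contradiction eq (All.lookup x∉xs (nth-∈ d j<))
  nth-injective d {x ∷ xs} {suc i} {zero} (x∉xs ∷ _) (s≤s i<) _ eq =
    contradiction (sym eq) (All.lookup x∉xs (nth-∈ d i<))
  nth-injective d {x ∷ xs} {suc i} {suc j} (_ ∷ xs-unique) (s≤s i<) (s≤s j<) eq =
    cong suc (nth-injective d xs-unique i< j< eq)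

  module _ (_≟_ : DecidableEquality A) where

    Unique⇒length≤ : ∀ {xs ys} → Unique xs → xs ⊆ˡ ys → length xs ≤ length ys
    Unique⇒length≤ [] _ = z≤n
    Unique⇒length≤ {x ∷ xs} {ys} (x∉xs ∷ xs-unique) xs⊆ys = begin-strict
      length xs             ≤⟨ Unique⇒length≤ xs-unique xs⊆others ⟩
      length others         <⟨ filter-notAll (¬? ∘ (x ≟_)) ys (Any.map (λ x≡y x≢y → x≢y x≡y) x∈ys) ⟩
      length ys             ∎
      where
        open ≤-Reasoning
        others = filter (¬? ∘ (x ≟_)) ys
        x∈ys = xs⊆ys (here refl)
        xs⊆others : xs ⊆ˡ others
        xs⊆others z∈xs = ∈-filter⁺ (¬? ∘ (x ≟_)) (xs⊆ys (there z∈xs)) (All.lookup x∉xs z∈xs)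

    position : A → List A → ℕ
    position x [] = 0
    position x (y ∷ ys) with x ≟ y
    ... | yes _ = 0
    ... | no _ = suc (position x ys)

    position-< : ∀ {x xs} → x ∈ˡ xs → position x xs < length xs
    position-< {x} {y ∷ ys} x∈ with x ≟ y | x∈
    ... | yes _ | _ = s≤s z≤n
    ... | no x≢y | here x≡y = contradiction x≡y x≢y
    ... | no _ | there x∈ys = s≤s (position-< x∈ys)

    nth-position : ∀ d {x xs} → x ∈ˡ xs → nth d xs (position x xs) ≡ x
    nth-position d {x} {y ∷ ys} x∈ with x ≟ y | x∈
    ... | yes x≡y | _ = sym x≡y
    ... | no x≢y | here x≡y = contradiction x≡y x≢y
    ... | no _ | there x∈ys = nth-position d x∈ys

    position-injective : ∀ {x y xs} → x ∈ˡ xs → y ∈ˡ xs → position x xs ≡ position y xs → x ≡ y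
    position-injective {x} {y} {xs} x∈ y∈ eq = begin
      x                       ≡⟨ sym (nth-position x x∈) ⟩
      nth x xs (position x xs) ≡⟨ cong (nth x xs) eq ⟩
      nth x xs (position y xs) ≡⟨ nth-position x y∈ ⟩
      y                       ∎
      where open ≡-Reasoning

avoiding : List ℕ → ℕ → List ℕ
avoiding F w = filter (λ i → ¬? (i ∈ˡ? F)) (upTo w)

avoiding-unique : ∀ F w → Unique (avoiding F w)
avoiding-unique F w = filter⁺ _ (upTo⁺ w)

∈-avoiding⁻ : ∀ {F i} w → i ∈ˡ avoiding F w → i < w × i ∉ˡ F
∈-avoiding⁻ {F} w i∈ = Product.map₁ ∈-upTo⁻ (∈-filter⁻ _ {xs = upTo w} i∈)

length-avoiding : ∀ F w → w ≤ length F + length (avoiding F w)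
length-avoiding F w = begin
  w                                  ≡⟨ length-upTo w ⟨
  length (upTo w)                    ≤⟨ Unique⇒length≤ ℕ._≟_ (upTo⁺ w) upTo⊆ ⟩
  length (F ++ avoiding F w)         ≡⟨ length-++ F ⟩
  length F + length (avoiding F w)   ∎
  where
    open ≤-Reasoning
    upTo⊆ : upTo w ⊆ˡ F ++ avoiding F w
    upTo⊆ {i} i∈ with i ∈ˡ? F
    ... | yes i∈F = ∈-++⁺ˡ i∈F
    ... | no i∉F = ∈-++⁺ʳ F (∈-filter⁺ _ i∈ i∉F)

Unique-bounded⇒length≤ : ∀ {xs k} → Unique xs → (∀ {x} → x ∈ˡ xs → x < k) → length xs ≤ k
Unique-bounded⇒length≤ {xs} {k} xs-unique bounded =
  subst (length xs ≤_) (length-upTo k) (Unique⇒length≤ ℕ._≟_ xs-unique (∈-upTo⁺ ∘ bounded))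

module _ {n : ℕ} where

  ∈⇔T-lookup : ∀ {S : Subset n} {x} → x ∈ S ⇔ T (lookup S x)
  ∈⇔T-lookup {S} {x} = mk⇔ (from 𝔹.T-≡ ∘ []=⇒lookup) (lookup⇒[]= x S ∘ to 𝔹.T-≡)

  ∈-tabulate : ∀ {f : Fin n → Bool} {x} → x ∈ tabulate f ⇔ T (f x)
  ∈-tabulate {f} {x} = subst (λ b → x ∈ tabulate f ⇔ T b) (lookup∘tabulate f x) ∈⇔T-lookup

  ∈-elems : ∀ {S : Subset n} {x} → x ∈ˡ elems S ⇔ x ∈ S
  ∈-elems {S} {x} = mk⇔ (proj₂ ∘ ∈-filter⁻ (_∈? S) {xs = allFin n}) (∈-filter⁺ (_∈? S) (∈-allFin x))

  elems-unique : ∀ S → Unique (elems S)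
  elems-unique S = filter⁺ (_∈? S) (allFin⁺ n)

  colours : (Fin n → ℕ) → Subset n → List ℕ
  colours φ S = deduplicate ℕ._≟_ (map φ (elems S))

  ∈-colours⁺ : ∀ {φ S x} → x ∈ S → φ x ∈ˡ colours φ S
  ∈-colours⁺ {φ} = ∈-deduplicate⁺ ℕ._≟_ ∘ ∈-map⁺ φ ∘ from ∈-elems

  ∈-colours⁻ : ∀ {φ S d} → d ∈ˡ colours φ S → ∃[ x ] (x ∈ S × d ≡ φ x)
  ∈-colours⁻ {φ} {S} d∈ =
    let x , x∈ , d≡φx = ∈-map⁻ φ (∈-deduplicate⁻ ℕ._≟_ (map φ (elems S)) d∈) in x , to ∈-elems x∈ , d≡φx

  colours-unique : ∀ φ S → Unique (colours φ S)
  colours-unique φ S = deduplicate-! (map φ (elems S))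

length-filter-∈-∷ : ∀ {m n b} {S : Subset n} (g : Fin m → Fin n) →
                    length (filter (_∈? (b ∷ S)) (List.tabulate (Fin.suc ∘ g))) ≡
                    length (filter (_∈? S) (List.tabulate g))
length-filter-∈-∷ {zero} g = refl
length-filter-∈-∷ {suc m} {S = S} g with does (g Fin.zero ∈? S)
... | true = cong suc (length-filter-∈-∷ (g ∘ Fin.suc))
... | false = length-filter-∈-∷ (g ∘ Fin.suc)

length-elems : ∀ {n} (S : Subset n) → length (elems S) ≡ ∣ S ∣
length-elems [] = refl
length-elems (true ∷ S) = cong suc (trans (length-filter-∈-∷ {S = S} id) (length-elems S))
length-elems (false ∷ S) = trans (length-filter-∈-∷ {S = S} id) (length-elems S)

imageSize≤n : ∀ {n} (φ : Fin n → ℕ) S → imageSize φ S ≤ n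
imageSize≤n {n} φ S = begin
  imageSize φ S                ≤⟨ length-deduplicate ℕ._≟_ (map φ (elems S)) ⟩
  length (map φ (elems S))     ≡⟨ length-map φ (elems S) ⟩
  length (elems S)             ≡⟨ length-elems S ⟩
  ∣ S ∣                        ≤⟨ ∣p∣≤n S ⟩
  n                            ∎
  where open ≤-Reasoning

colours-bounded : ∀ {n k} {φ : Fin n → ℕ} {S d} → (∀ u → φ u < k) → d ∈ˡ colours φ S → d < k
colours-bounded bounded d∈ with ∈-colours⁻ d∈
... | x , _ , refl = bounded x

module _ {n : ℕ} (G : Graph n) where

  edge-sym : ∀ {u v} → Edge G u v → Edge G v u
  edge-sym {u} {v} e = trans (Graph.sym G v u) e

  edge⇒≢ : ∀ {u v} → Edge G u v → u ≢ v
  edge⇒≢ {u} e refl with trans (sym e) (irrefl G u)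
  ... | ()

  edge? : ∀ u v → Dec (Edge G u v)
  edge? u v = adj G u v 𝔹.≟ true

  closedNbhd? : ∀ u v → Dec (InClosedNbhd G u v)
  closedNbhd? u v = (v Fin.≟ u) ⊎-dec edge? u v

  walk-head : ∀ {P u v} → WalkIn G P u v → P u
  walk-head (here pu) = pu
  walk-head (step pu _ _) = pu

  colourable? : ∀ k → Dec (Colourable G k)
  colourable? k = anyFunction? respects proper?
    where
      respects : ∀ {c c′} → c ≗ c′ → ProperColouring G k c → ProperColouring G k c′
      respects c≗c′ proper u v e c′u≡c′v = proper u v e (trans (c≗c′ u) (trans c′u≡c′v (sym (c≗c′ v))))
      proper? : Decidable (ProperColouring G k)
      proper? c = all? λ u → all? λ v → edge? u v →-dec ¬? (c u Fin.≟ c v)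

  identity-colourable : Colourable G n
  identity-colourable = id , λ _ _ → edge⇒≢

  colourable-fromℕ : ∀ {k} (φ : Fin n → ℕ) → (∀ u → φ u < k) → (∀ u v → Edge G u v → φ u ≢ φ v) →
                     Colourable G k
  colourable-fromℕ φ bounded proper =
    (λ u → fromℕ< (bounded u)) ,
    λ u v e c-eq → proper u v e (trans (sym (toℕ-fromℕ< _)) (trans (cong toℕ c-eq) (toℕ-fromℕ< _)))

  SameClosedNbhd : Fin n → Fin n → Set
  SameClosedNbhd u v = ∀ w → InClosedNbhd G u w ⇔ InClosedNbhd G v w

  sameClosedNbhd⇒edge : ∀ {u v} → SameClosedNbhd u v → u ≢ v → Edge G u v
  sameClosedNbhd⇒edge {u} same u≢v with to (same u) (inj₁ refl)
  ... | inj₁ u≡v = contradiction u≡v u≢v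
  ... | inj₂ vu = edge-sym vu

  sameClosedNbhd-edge : ∀ {u v x} → SameClosedNbhd u v → Edge G v x → x ≢ u → Edge G u x
  sameClosedNbhd-edge {x = x} same vx x≢u with from (same x) (inj₂ vx)
  ... | inj₁ x≡u = contradiction x≡u x≢u
  ... | inj₂ ux = ux

  module _ {X : Subset n} where

    IsM-≤ : ∀ {S j j′} → IsM G X S j → IsM G X S j′ → j ≤ j′
    IsM-≤ (_ , inj₁ refl) _ = z≤n
    IsM-≤ (_ , inj₂ (C , C-tc , NX≡S , refl)) (bound , _) = bound C C-tc NX≡S

    IsM⇒≤n : ∀ {S j} → IsM G X S j → j ≤ n
    IsM⇒≤n (_ , inj₁ refl) = z≤n
    IsM⇒≤n (_ , inj₂ (C , _ , _ , refl)) = ∣p∣≤n C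

module TwinCoverColouring {n : ℕ} (G : Graph n) {X : Subset n} (cover : TwinCover G X) where

  twinEdge⇒same : ∀ {u v} → u ∉ X → v ∉ X → Edge G u v → SameClosedNbhd G u v
  twinEdge⇒same u∉X v∉X e = proj₂ (proj₂ (cover _ _ u∉X v∉X e))

  walk⇒same : ∀ {u v} → WalkIn G (_∉ X) u v → SameClosedNbhd G u v
  walk⇒same (here _) _ = ⇔.refl
  walk⇒same (step u∉X e walk) w = ⇔.trans (twinEdge⇒same u∉X (walk-head G walk) e w) (walk⇒same walk w)

  ∈-NX⁺ : ∀ {C x c} → x ∈ X → c ∈ C → Edge G x c → x ∈ NX G X C
  ∈-NX⁺ {C} {x} x∈X c∈C xc = from ∈-tabulate (from 𝔹.T-∧ (to ∈⇔T-lookup x∈X ,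
    any⁺ (λ c → lookup C c ∧ adj G x c)
      (lose (∈-allFin _) (from 𝔹.T-∧ (to ∈⇔T-lookup c∈C , from 𝔹.T-≡ xc)))))

  ∈-NX⁻ : ∀ {C x} → x ∈ NX G X C → x ∈ X × ∃[ c ] (c ∈ C × Edge G x c)
  ∈-NX⁻ x∈ =
    let x∈X , adjacent = to 𝔹.T-∧ (to ∈-tabulate x∈)
        c , c-adjacent = Any.satisfied (any⁻ _ (allFin n) adjacent)
        c∈C , xc = to 𝔹.T-∧ c-adjacent
    in from ∈⇔T-lookup x∈X , c , from ∈⇔T-lookup c∈C , to 𝔹.T-≡ xc

  NX⊆X : ∀ C → NX G X C ⊆ X
  NX⊆X C = proj₁ ∘ ∈-NX⁻ {C}

  twinClique-same : ∀ {C u v} → TwinClique G X C → u ∈ C → v ∈ C → SameClosedNbhd G u v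
  twinClique-same (_ , _ , walks , _) u∈C v∈C = walk⇒same (walks _ _ u∈C v∈C)

  twinClique-complete : ∀ {C u v} → TwinClique G X C → u ∈ C → v ∈ C → u ≢ v → Edge G u v
  twinClique-complete C-tc u∈C v∈C = sameClosedNbhd⇒edge G (twinClique-same C-tc u∈C v∈C)

  twinClique-joined : ∀ {C x u} → TwinClique G X C → x ∈ NX G X C → u ∈ C → Edge G u x
  twinClique-joined C-tc@(_ , outside , _) x∈NX u∈C =
    let x∈X , c , c∈C , xc = ∈-NX⁻ x∈NX
    in sameClosedNbhd-edge G (twinClique-same C-tc u∈C c∈C) (edge-sym G xc)
         (λ x≡u → outside _ u∈C (subst (_∈ X) x≡u x∈X))

  inComponent? : ∀ v u → Dec (u ∉ X × InClosedNbhd G v u)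
  inComponent? v u = ¬? (u ∈? X) ×-dec closedNbhd? G v u

  component : Fin n → Subset n
  component v = tabulate (isYes ∘ inComponent? v)

  ∈-component : ∀ {v u} → u ∈ component v ⇔ (u ∉ X × InClosedNbhd G v u)
  ∈-component {v} {u} =
    mk⇔ (toWitness {a? = inComponent? v u} ∘ to ∈-tabulate) (from ∈-tabulate ∘ fromWitness)

  ∈-own-component : ∀ {v} → v ∉ X → v ∈ component v
  ∈-own-component v∉X = from ∈-component (v∉X , inj₁ refl)

  component-isTwinClique : ∀ {v} → v ∉ X → TwinClique G X (component v)
  component-isTwinClique {v} v∉X =
    (v , ∈-own-component v∉X) , (λ _ → proj₁ ∘ to ∈-component) , walk , closed
    where
      walk : ∀ u u′ → u ∈ component v → u′ ∈ component v → WalkIn G (_∉ X) u u′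
      walk u u′ u∈ u′∈ with to ∈-component u∈ | to ∈-component u′∈
      ... | _ , inj₁ refl | _ , inj₁ refl = here v∉X
      ... | _ , inj₁ refl | u′∉X , inj₂ vu′ = step v∉X vu′ (here u′∉X)
      ... | u∉X , inj₂ vu | _ , inj₁ refl = step u∉X (edge-sym G vu) (here v∉X)
      ... | u∉X , inj₂ vu | u′∉X , inj₂ vu′ = step u∉X (edge-sym G vu) (step v∉X vu′ (here u′∉X))

      closed : ∀ u w → u ∈ component v → w ∉ X → Edge G u w → w ∈ component v
      closed u w u∈ w∉X uw with to ∈-component u∈
      ... | _ , inj₁ refl = from ∈-component (w∉X , inj₂ uw)
      ... | u∉X , inj₂ vu = from ∈-component (w∉X , from (twinEdge⇒same v∉X u∉X vu w) (inj₂ uw))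

  twinClique≡component : ∀ {C v} → TwinClique G X C → v ∈ C → C ≡ component v
  twinClique≡component {C} {v} C-tc@(_ , outside , _ , closed) v∈C = ⊆-antisym C⊆ ⊆C
    where
      C⊆ : C ⊆ component v
      C⊆ u∈C = from ∈-component (outside _ u∈C , to (twinClique-same C-tc u∈C v∈C _) (inj₁ refl))

      ⊆C : component v ⊆ C
      ⊆C u∈ with to ∈-component u∈
      ... | _ , inj₁ refl = v∈C
      ... | u∉X , inj₂ vu = closed _ _ v∈C u∉X vu

  component-cong : ∀ {u v} → u ∉ X → v ∉ X → Edge G u v → component u ≡ component v
  component-cong u∉X v∉X uv =
    sym (twinClique≡component (component-isTwinClique v∉X) (from ∈-component (u∉X , inj₂ (edge-sym G uv))))

  -- A twin-clique is the component of any of its vertices, so m(S) is a maximum over vertices.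
  ∃-IsM : ∀ S → ∃ (IsM G X S)
  ∃-IsM S =
    Product.map₂ fromIsMax₀ (∃-IsMax₀ InTwinCliqueOverS size exceeded? (λ v _ → ∣p∣≤n (component v)))
    where
      InTwinCliqueOverS : Fin n → Set
      InTwinCliqueOverS v = v ∉ X × NX G X (component v) ≡ S

      size : Fin n → ℕ
      size v = ∣ component v ∣

      exceeded? : Decidable (Exceeded InTwinCliqueOverS size)
      exceeded? t = any? λ v → (¬? (v ∈? X) ×-dec ≡-dec 𝔹._≟_ (NX G X (component v)) S) ×-dec (t <? size v)

      fromIsMax₀ : ∀ {k} → IsMax₀ InTwinCliqueOverS size k → IsM G X S k
      fromIsMax₀ {k} (bound , attained) = twinClique-bound , Sum.map₂ component-attains attained
        where
          twinClique-bound : ∀ C → TwinClique G X C → NX G X C ≡ S → ∣ C ∣ ≤ k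
          twinClique-bound C C-tc@((v , v∈C) , outside , _) NX≡S with twinClique≡component C-tc v∈C
          ... | refl = bound v (outside v v∈C , NX≡S)

          component-attains : ∃[ v ] (InTwinCliqueOverS v × size v ≡ k) →
                              ∃[ C ] (TwinClique G X C × NX G X C ≡ S × ∣ C ∣ ≡ k)
          component-attains (v , (v∉X , NX≡S) , size≡k) =
            component v , component-isTwinClique v∉X , NX≡S , size≡k

  m : Subset n → ℕ
  m S = proj₁ (∃-IsM S)

  m-IsM : ∀ S → IsM G X S (m S)
  m-IsM S = proj₂ (∃-IsM S)

  IsM⇒≡m : ∀ {S j} → IsM G X S j → j ≡ m S
  IsM⇒≡m j-IsM = ≤-antisym (IsM-≤ G j-IsM (m-IsM _)) (IsM-≤ G (m-IsM _) j-IsM)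

  ∃-IsMaxValue : ∀ φ → ∃ (IsMaxValue G X φ)
  ∃-IsMaxValue φ = Product.map₂ fromIsMax₀ (∃-IsMax₀ (_⊆ X) value exceeded? bounded)
    where
      value : Subset n → ℕ
      value S = imageSize φ S + m S

      exceeded? : Decidable (Exceeded (_⊆ X) value)
      exceeded? t = anySubset? λ S → (S ⊆? X) ×-dec (t <? value S)

      bounded : ∀ S → S ⊆ X → value S ≤ n + n
      bounded S _ = +-mono-≤ (imageSize≤n φ S) (IsM⇒≤n G (m-IsM S))

      fromIsMax₀ : ∀ {v} → IsMax₀ (_⊆ X) value v → IsMaxValue G X φ v
      fromIsMax₀ {v} (bound , attained) = bound′ , attaining attained
        where
          bound′ : ∀ S j → S ⊆ X → IsM G X S j → imageSize φ S + j ≤ v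
          bound′ S j S⊆X j-IsM rewrite IsM⇒≡m j-IsM = bound S S⊆X

          attaining : v ≡ 0 ⊎ ∃[ S ] (S ⊆ X × value S ≡ v) →
                      ∃[ S ] ∃[ j ] (S ⊆ X × IsM G X S j × imageSize φ S + j ≡ v)
          attaining (inj₁ refl) = X , m X , ⊆-refl , m-IsM X , n≤0⇒n≡0 (bound X ⊆-refl)
          attaining (inj₂ (S , S⊆X , value≡v)) = S , m S , S⊆X , m-IsM S , value≡v

  IsM-colour-bound : ∀ {φ k} → (∀ u → φ u < k) → (∀ u v → Edge G u v → φ u ≢ φ v) →
                     ∀ {S j} → IsM G X S j → imageSize φ S + j ≤ k
  IsM-colour-bound {φ} {k} bounded proper {S} (_ , inj₁ refl) =
    subst (_≤ k) (sym (+-identityʳ _))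
      (Unique-bounded⇒length≤ (colours-unique φ S) (colours-bounded bounded))
  IsM-colour-bound {φ} {k} bounded proper (_ , inj₂ (C , C-tc , refl , refl)) =
    subst (_≤ k) length-palette (Unique-bounded⇒length≤ palette-unique palette-bounded)
    where
      palette : List ℕ
      palette = colours φ (NX G X C) ++ map φ (elems C)

      length-palette : length palette ≡ imageSize φ (NX G X C) + ∣ C ∣
      length-palette = trans (length-++ (colours φ (NX G X C)))
        (cong (imageSize φ (NX G X C) +_) (trans (length-map φ (elems C)) (length-elems C)))

      injective : ∀ {x y} → x ∈ˡ elems C → y ∈ˡ elems C → φ x ≡ φ y → x ≡ y
      injective {x} {y} x∈ y∈ φx≡φy with x Fin.≟ y
      ... | yes x≡y = x≡y
      ... | no x≢y =
        contradiction φx≡φy (proper x y (twinClique-complete C-tc (to ∈-elems x∈) (to ∈-elems y∈) x≢y))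

      disjoint : ∀ {d} → ¬ (d ∈ˡ colours φ (NX G X C) × d ∈ˡ map φ (elems C))
      disjoint (d∈NX , d∈C) with ∈-colours⁻ d∈NX | ∈-map⁻ φ d∈C
      ... | x , x∈NX , refl | u , u∈ , φx≡φu =
        proper u x (twinClique-joined C-tc x∈NX (to ∈-elems u∈)) (sym φx≡φu)

      palette-unique : Unique palette
      palette-unique = ++⁺ (colours-unique φ (NX G X C)) (Unique-map⁺ injective (elems-unique C)) disjoint

      palette-bounded : ∀ {d} → d ∈ˡ palette → d < k
      palette-bounded d∈ with ∈-++⁻ (colours φ (NX G X C)) d∈
      ... | inj₁ d∈NX = colours-bounded bounded d∈NX
      ... | inj₂ d∈C with ∈-map⁻ φ d∈C
      ...   | u , _ , refl = bounded u

  maxValue≤colours : ∀ {k c v} → ProperColouring G k c → IsMaxValue G X (toℕ ∘ c) v → v ≤ k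
  maxValue≤colours {c = c} c-proper (_ , S , j , _ , j-IsM , value≡v) =
    subst (_≤ _) value≡v (IsM-colour-bound (toℕ<n ∘ c) (λ u v e → c-proper u v e ∘ toℕ-injective) j-IsM)

  module Extension {φ : Fin n → ℕ} (φ-proper : ProperColouringOn G X φ) {w : ℕ}
                   (w-bound : ∀ S j → S ⊆ X → IsM G X S j → imageSize φ S + j ≤ w) where

    palette : List ℕ
    palette = colours φ X

    -- φ may use arbitrary numbers on X; renaming them by their position in the palette puts them
    -- below |φ(X)| ≤ w.
    relabel : ℕ → ℕ
    relabel d = position ℕ._≟_ d palette

    forbidden : Subset n → List ℕ
    forbidden C = map relabel (colours φ (NX G X C))

    available : Subset n → List ℕ
    available C = avoiding (forbidden C) w

    ∣C∣≤available : ∀ {C} → TwinClique G X C → ∣ C ∣ ≤ length (available C)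
    ∣C∣≤available {C} C-tc = +-cancelˡ-≤ (imageSize φ S) _ _ (begin
      imageSize φ S + ∣ C ∣                           ≤⟨ +-monoʳ-≤ _ (proj₁ (m-IsM S) C C-tc refl) ⟩
      imageSize φ S + m S                             ≤⟨ w-bound S (m S) (NX⊆X C) (m-IsM S) ⟩
      w                                               ≤⟨ length-avoiding (forbidden C) w ⟩
      length (forbidden C) + length (available C)     ≡⟨ cong (_+ length (available C)) length-forbidden ⟩
      imageSize φ S + length (available C)            ∎)
      where
        open ≤-Reasoning
        S = NX G X C
        length-forbidden = length-map relabel (colours φ S)

    colourIn : Subset n → Fin n → ℕ
    colourIn C u = nth 0 (available C) (position Fin._≟_ u (elems C))

    module _ {C} (C-tc : TwinClique G X C) where

      position-<-available : ∀ {u} → u ∈ C → position Fin._≟_ u (elems C) < length (available C)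
      position-<-available {u} u∈C = <-≤-trans
        (subst (position Fin._≟_ u (elems C) <_) (length-elems C) (position-< Fin._≟_ (from ∈-elems u∈C)))
        (∣C∣≤available C-tc)

      colourIn-∈ : ∀ {u} → u ∈ C → colourIn C u ∈ˡ available C
      colourIn-∈ u∈C = nth-∈ 0 (position-<-available u∈C)

      colourIn-injective : ∀ {u v} → u ∈ C → v ∈ C → colourIn C u ≡ colourIn C v → u ≡ v
      colourIn-injective u∈C v∈C = position-injective Fin._≟_ (from ∈-elems u∈C) (from ∈-elems v∈C)
        ∘ nth-injective 0 (avoiding-unique (forbidden C) w)
            (position-<-available u∈C) (position-<-available v∈C)

    colour : Fin n → ℕ
    colour u with u ∈? X
    ... | yes _ = relabel (φ u)
    ... | no _ = colourIn (component u) u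

    colour-< : ∀ u → colour u < w
    colour-< u with u ∈? X
    ... | yes u∈X = <-≤-trans (position-< ℕ._≟_ (∈-colours⁺ u∈X))
                              (≤-trans (m≤m+n _ _) (w-bound X (m X) ⊆-refl (m-IsM X)))
    ... | no u∉X = proj₁ (∈-avoiding⁻ w (colourIn-∈ (component-isTwinClique u∉X) (∈-own-component u∉X)))

    mixed-proper : ∀ {u v} → u ∈ X → v ∉ X → Edge G u v → relabel (φ u) ≢ colourIn (component v) v
    mixed-proper {u} {v} u∈X v∉X uv colours-eq =
      proj₂ (∈-avoiding⁻ w (colourIn-∈ (component-isTwinClique v∉X) v∈))
        (subst (_∈ˡ forbidden (component v)) colours-eq (∈-map⁺ relabel (∈-colours⁺ (∈-NX⁺ u∈X v∈ uv))))
      where v∈ = ∈-own-component v∉X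

    outside-proper : ∀ {u v} → u ∉ X → v ∉ X → Edge G u v →
                     colourIn (component u) u ≢ colourIn (component v) v
    outside-proper {u} {v} u∉X v∉X uv rewrite component-cong u∉X v∉X uv =
      edge⇒≢ G uv ∘ colourIn-injective (component-isTwinClique v∉X)
        (from ∈-component (u∉X , inj₂ (edge-sym G uv))) (∈-own-component v∉X)

    colour-proper : ∀ u v → Edge G u v → colour u ≢ colour v
    colour-proper u v uv with u ∈? X | v ∈? X
    ... | yes u∈X | yes v∈X =
      φ-proper u v u∈X v∈X uv ∘ position-injective ℕ._≟_ (∈-colours⁺ u∈X) (∈-colours⁺ v∈X)
    ... | yes u∈X | no v∉X = mixed-proper u∈X v∉X uv
    ... | no u∉X | yes v∈X = mixed-proper v∈X u∉X (edge-sym G uv) ∘ sym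
    ... | no u∉X | no v∉X = outside-proper u∉X v∉X uv

    colourable : Colourable G w
    colourable = colourable-fromℕ G colour colour-< colour-proper

  colourable-from : ∀ {φ w} → ProperColouringOn G X φ →
                    (∀ S j → S ⊆ X → IsM G X S j → imageSize φ S + j ≤ w) → Colourable G w
  colourable-from φ-proper w-bound = Extension.colourable φ-proper w-bound

corollary5 : (n : ℕ) (G : Graph n) (X : Subset n) →
    Connected G → TwinCover G X →
    ∃[ k ] (IsChromaticNumber G k × IsMinMaxValue G X k)
corollary5 n G X _ cover =
  let χ , (c , c-proper) , χ-least = least (colourable? G) (identity-colourable G)
      φ = toℕ ∘ c
      φ-proper : ProperColouringOn G X φ
      φ-proper x y _ _ xy = c-proper x y xy ∘ toℕ-injective
      v , v-max = ∃-IsMaxValue φ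
      v≡χ = ≤-antisym (maxValue≤colours c-proper v-max) (χ-least v (colourable-from φ-proper (proj₁ v-max)))
  in χ , ((c , c-proper) , χ-least) , (φ , φ-proper , subst (IsMaxValue G X φ) v≡χ v-max) ,
     λ ψ w ψ-proper w-max → χ-least w (colourable-from ψ-proper (proj₁ w-max))
  where open TwinCoverColouring G cover
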